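{- Let $q\geq 1$ and $L\geq 1$ be integers. Then $$\sum_{k=0}^{qL}k\binom{L}{k}_{q}=(q+1)^{L}\frac{qL}{2},\qquad \sum_{k=0}^{qL}k^{2}\binom{L}{k}_{q}=(q+1)^{L}\frac{qL}{2}\Bigl(\frac{qL}{2}+\frac{q+2}{6}\Bigr),$$ $$\sum_{k=0}^{qL}k^{3}\binom{L}{k}_{q}=(q+1)^{L}\Bigl(\frac{qL}{2}\Bigr)^{2}\Bigl(\frac{qL}{2}+\frac{q+2}{2}\Bigr).$$ More generally, for every integer $m\geq 1$, $$\sum_{k=0}^{qL}k^{m}\binom{L}{k}_{q}=(q+1)^{L}\sum_{i_1+i_2+\cdots+i_L=m}\binom{m}{i_1,i_2,\ldots,i_L}u_{i_1}u_{i_2}\cdots u_{i_L},$$ where the sum runs over nonnegative integers $i_1,\ldots,i_L$ and $u_i=\frac{1}{q+1}\sum_{j=0}^{q}j^{i}$ (with $u_0=1$) is the $i$-th moment of the discrete uniform distribution on $\{0,1,\ldots,q\}$.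
   Context: For integers $q\geq 1$, $L\geq 0$, the ordinary multinomial $\binom{L}{a}_{q}$ is the coefficient of $x^{a}$ in $(1+x+\cdots+x^{q})^{L}$. $\binom{m}{i_1,\ldots,i_L}$ is the usual multinomial coefficient. -}

module Defs where

open import Data.Nat using (ℕ; zero; suc; _+_; _*_; _∸_; _^_; _!; NonZero)
import Data.Nat as ℕ
open import Data.Nat.Properties using (m*n≢0; _!≢0)
open import Data.List using (List; []; _∷_; [_]; map; replicate; upTo; concatMap)
open import Data.Nat.ListAction using (sum)
open import Data.Vec using (Vec; []; _∷_)
open import Data.Integer using (+_)
open import Data.Rational using (ℚ; _/_)
import Data.Rational as ℚ

-- Polynomials with ℕ coefficients as coefficient lists (constant term first)

infixl 6 _⊕_
infixl 7 _⊗_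

_⊕_ : List ℕ → List ℕ → List ℕ
[] ⊕ ys = ys
(x ∷ xs) ⊕ [] = x ∷ xs
(x ∷ xs) ⊕ (y ∷ ys) = (x + y) ∷ (xs ⊕ ys)

_⊗_ : List ℕ → List ℕ → List ℕ
[] ⊗ ys = []
(x ∷ xs) ⊗ ys = map (x *_) ys ⊕ (0 ∷ (xs ⊗ ys))

polyPow : List ℕ → ℕ → List ℕ
polyPow p zero = [ 1 ]
polyPow p (suc L) = p ⊗ polyPow p L

coeff : List ℕ → ℕ → ℕ
coeff [] _ = 0
coeff (x ∷ xs) zero = x
coeff (x ∷ xs) (suc a) = coeff xs a

geomPoly : ℕ → List ℕ
geomPoly q = replicate (suc q) 1

-- ordinary multinomial  binom(L, a)_q  = [x^a] (1 + x + ... + x^q)^L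
ordMultinomial : (q L a : ℕ) → ℕ
ordMultinomial q L a = coeff (polyPow (geomPoly q) L) a

-- all (i₁,…,i_L) ∈ ℕ^L with i₁ + … + i_L = m (each exactly once)
compositions : (L m : ℕ) → List (Vec ℕ L)
compositions zero zero = [ [] ]
compositions zero (suc m) = []
compositions (suc L) m =
  concatMap (λ i → map (i ∷_) (compositions L (m ∸ i))) (upTo (suc m))

prodFact : ∀ {n} → Vec ℕ n → ℕ
prodFact [] = 1
prodFact (i ∷ is) = (i !) * prodFact is

prodFact≢0 : ∀ {n} (is : Vec ℕ n) → NonZero (prodFact is)
prodFact≢0 [] = _
prodFact≢0 (i ∷ is) = m*n≢0 (i !) (prodFact is) {{i !≢0}} {{prodFact≢0 is}}

multinomial : ∀ {n} → ℕ → Vec ℕ n → ℕ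
multinomial m is = ℕ._/_ (m !) (prodFact is) {{prodFact≢0 is}}

toℚ : ℕ → ℚ
toℚ n = (+ n) / 1

sumℚ : List ℚ → ℚ
sumℚ [] = ℚ.0ℚ
sumℚ (x ∷ xs) = x ℚ.+ sumℚ xs

prodℚ : ∀ {n} → Vec ℚ n → ℚ
prodℚ [] = ℚ.1ℚ
prodℚ (x ∷ xs) = x ℚ.* prodℚ xs

-- u_i = (1/(q+1)) Σ_{j=0}^{q} j^i   (note 0^0 = 1, so u_0 = 1)
moment : (q i : ℕ) → ℚ
moment q i = (+ sum (map (λ j → j ^ i) (upTo (suc q)))) / suc q

momentSum : (q L m : ℕ) → ℕ
momentSum q L m = sum (map (λ k → k ^ m * ordMultinomial q L k) (upTo (suc (q * L))))

module Submission where

-- Write P = (1 + x + ⋯ + x^q)^L as a coefficient list and pair it with a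
-- weight g : ℕ → ℕ by ⟨ P ∣ g ⟩ = Σ_k P_k g(k); the moment sum
-- Σ_k k^m binom(L,k)_q is ⟨ P ∣ (_^ m) ⟩.  Multiplying a polynomial by
-- 1 + x + ⋯ + x^q shifts the weight, so the binomial theorem gives the
-- recursion in L
--     M(L+1, m) = Σ_i C(m,i) s_i M(L, m-i),    s_i = Σ_{j ≤ q} j^i.
-- The weighted sum over compositions Σ_{i₁+⋯+i_L = m} C(m; i₁,…,i_L) s_{i₁}⋯s_{i_L}
-- obeys the same recursion (split off i₁), and both sides agree at L = 0, so
-- they coincide.  Dividing through by (q+1)^L = Π (q+1) turns s_i into the
-- uniform moment u_i = s_i/(q+1), which is the general formula in ℚ.  The
-- cases m = 1, 2, 3 instead follow from the recursion together with the
-- Faulhaber formulas for s_0, …, s_3, proved over ℕ with denominators cleared.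

open import Defs
open import Data.Nat using (ℕ; _≥_; _+_; _*_; _^_)
open import Data.Vec using (Vec; map)
import Data.List as List
open import Data.Integer using (+_)
open import Data.Rational using (ℚ; _/_) renaming (_*_ to _*ℚ_; _+_ to _+ℚ_)
open import Data.Product using (_×_; _,_)
open import Relation.Binary.PropositionalEquality using (_≡_)

open import Data.Nat using (zero; suc; _∸_; _≤_; z≤n; s≤s; _!; pred)
open import Data.Nat.Properties
open import Data.Nat.Combinatorics using (_C_; k![n∸k]!∣n!)
open import Data.Nat.Combinatorics.Specification using (nCk≡n!/k![n-k]!)
open import Data.Nat.DivMod using (m/n*n≡m; m*n/n≡m)
open import Data.Nat.Tactic.RingSolver using (solve-∀)
open import Data.Fin using (Fin; toℕ)
open import Data.List using (List; []; _∷_; applyUpTo; upTo; concatMap; replicate; length)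
open import Data.List.Properties using (map-++; map-∘; map-cong; map-cong-local; length-map; length-replicate)
open import Data.List.Relation.Unary.All as All using (All; []; _∷_)
open import Data.List.Relation.Unary.All.Properties using (concat⁺; map⁺; applyUpTo⁺₁)
open import Data.Nat.ListAction using (sum)
open import Data.Nat.ListAction.Properties using (sum-++)
open import Data.Vec using ([]; _∷_)
open import Data.Integer.Properties using (pos-*; pos-+)
import Data.Integer as ℤ
open import Data.Rational using (fromℚᵘ)
open import Data.Rational.Properties as ℚ
  using (fromℚᵘ-cong; toℚᵘ-injective; toℚᵘ-fromℚᵘ; toℚᵘ-homo-*; toℚᵘ-homo-+; /-cong)
open import Data.Rational.Unnormalised as ℚᵘ using (ℚᵘ; mkℚᵘ; *≡*)
import Data.Rational.Unnormalised.Properties as ℚᵘ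
open import Algebra.Bundles using (CommutativeMonoid)
import Algebra.Properties.CommutativeSemigroup as CommSemigroupProperties
module ℕ-* = CommSemigroupProperties *-commutativeSemigroup
module ℚ-* = CommSemigroupProperties (CommutativeMonoid.commutativeSemigroup ℚ.*-1-commutativeMonoid)
open import Algebra.Properties.Semiring.Sum +-*-semiring
  using (sum-syntax; sum-cong-≗; sum-replicate-zero; ∑-comm; ∑-distrib-+; *-distribˡ-sum; *-distribʳ-sum)
import Algebra.Properties.CommutativeSemiring.Binomial +-*-commutativeSemiring as Binomial
import Algebra.Properties.Semiring.Exp +-*-semiring as Exp
import Algebra.Properties.Semiring.Mult +-*-semiring as Mult
open import Function using (_∘_)
open import Relation.Binary.PropositionalEquality using (refl; sym; trans; cong; cong₂; subst; subst₂; module ≡-Reasoning)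
open ≡-Reasoning

sum-applyUpTo : ∀ n (f g : ℕ → ℕ) →
  sum (List.map f (applyUpTo g n)) ≡ ∑[ i < n ] f (g (toℕ i))
sum-applyUpTo zero    f g = refl
sum-applyUpTo (suc n) f g = cong (_+_ (f (g 0))) (sum-applyUpTo n f (g ∘ suc))

∑-snoc : ∀ n (f : ℕ → ℕ) → ∑[ j < suc n ] f (toℕ j) ≡ ∑[ j < n ] f (toℕ j) + f n
∑-snoc zero    f = +-comm (f 0) 0
∑-snoc (suc n) f = trans (cong (_+_ (f 0)) (∑-snoc n (f ∘ suc))) (sym (+-assoc (f 0) _ _))

^-agrees : ∀ x n → x Exp.^ n ≡ x ^ n
^-agrees x zero    = refl
^-agrees x (suc n) = cong (x *_) (^-agrees x n)

×-agrees : ∀ n x → n Mult.× x ≡ n * x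
×-agrees zero    x = refl
×-agrees (suc n) x = cong (_+_ x) (×-agrees n x)

binomial-theorem : ∀ n x y →
  (x + y) ^ n ≡ ∑[ k < suc n ] ((n C toℕ k) * (x ^ toℕ k * y ^ (n ∸ toℕ k)))
binomial-theorem n x y = begin
  (x + y) ^ n                         ≡⟨ ^-agrees (x + y) n ⟨
  (x + y) Exp.^ n                     ≡⟨ Binomial.theorem n x y ⟩
  Binomial.binomialExpansion x y n    ≡⟨ sum-cong-≗ {suc n} term ⟩
  ∑[ k < suc n ] ((n C toℕ k) * (x ^ toℕ k * y ^ (n ∸ toℕ k))) ∎
  where
  term : ∀ k → Binomial.binomialTerm x y n k ≡ (n C toℕ k) * (x ^ toℕ k * y ^ (n ∸ toℕ k))
  term k = trans (×-agrees (n C toℕ k) _)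
    (cong ((n C toℕ k) *_) (cong₂ _*_ (^-agrees x (toℕ k)) (^-agrees y (n ∸ toℕ k))))

⟨_∣_⟩ : List ℕ → (ℕ → ℕ) → ℕ
⟨ []    ∣ g ⟩ = 0
⟨ a ∷ p ∣ g ⟩ = a * g 0 + ⟨ p ∣ g ∘ suc ⟩

pair-cong : ∀ p {g h : ℕ → ℕ} → (∀ k → g k ≡ h k) → ⟨ p ∣ g ⟩ ≡ ⟨ p ∣ h ⟩
pair-cong []      g≗h = refl
pair-cong (a ∷ p) g≗h = cong₂ _+_ (cong (a *_) (g≗h 0)) (pair-cong p (g≗h ∘ suc))

pair-⊕ : ∀ p r g → ⟨ p ⊕ r ∣ g ⟩ ≡ ⟨ p ∣ g ⟩ + ⟨ r ∣ g ⟩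
pair-⊕ []      r       g = refl
pair-⊕ (a ∷ p) []      g = sym (+-identityʳ _)
pair-⊕ (a ∷ p) (b ∷ r) g = begin
  (a + b) * g 0 + ⟨ p ⊕ r ∣ g ∘ suc ⟩
    ≡⟨ cong (_+_ ((a + b) * g 0)) (pair-⊕ p r (g ∘ suc)) ⟩
  (a + b) * g 0 + (⟨ p ∣ g ∘ suc ⟩ + ⟨ r ∣ g ∘ suc ⟩)
    ≡⟨ rearrange a b (g 0) _ _ ⟩
  (a * g 0 + ⟨ p ∣ g ∘ suc ⟩) + (b * g 0 + ⟨ r ∣ g ∘ suc ⟩) ∎
  where
  rearrange : ∀ a b x u v → (a + b) * x + (u + v) ≡ (a * x + u) + (b * x + v)
  rearrange = solve-∀

pair-scale : ∀ c p g → ⟨ List.map (c *_) p ∣ g ⟩ ≡ c * ⟨ p ∣ g ⟩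
pair-scale c []      g = sym (*-zeroʳ c)
pair-scale c (a ∷ p) g = begin
  c * a * g 0 + ⟨ List.map (c *_) p ∣ g ∘ suc ⟩ ≡⟨ cong₂ _+_ (*-assoc c a (g 0)) (pair-scale c p (g ∘ suc)) ⟩
  c * (a * g 0) + c * ⟨ p ∣ g ∘ suc ⟩           ≡⟨ *-distribˡ-+ c (a * g 0) _ ⟨
  c * (a * g 0 + ⟨ p ∣ g ∘ suc ⟩)               ∎

pair-* : ∀ p c h → ⟨ p ∣ (λ k → c * h k) ⟩ ≡ c * ⟨ p ∣ h ⟩
pair-* []      c h = sym (*-zeroʳ c)
pair-* (a ∷ p) c h = begin
  a * (c * h 0) + ⟨ p ∣ (λ k → c * h (suc k)) ⟩ ≡⟨ cong₂ _+_ (ℕ-*.x∙yz≈y∙xz a c (h 0)) (pair-* p c (h ∘ suc)) ⟩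
  c * (a * h 0) + c * ⟨ p ∣ h ∘ suc ⟩           ≡⟨ *-distribˡ-+ c (a * h 0) _ ⟨
  c * (a * h 0 + ⟨ p ∣ h ∘ suc ⟩)               ∎

pair-∑ : ∀ p n (F : Fin n → ℕ → ℕ) → ⟨ p ∣ (λ k → ∑[ i < n ] F i k) ⟩ ≡ ∑[ i < n ] ⟨ p ∣ F i ⟩
pair-∑ []      n F = sym (sum-replicate-zero n)
pair-∑ (a ∷ p) n F = begin
  a * ∑[ i < n ] F i 0 + ⟨ p ∣ (λ k → ∑[ i < n ] F i (suc k)) ⟩
    ≡⟨ cong₂ _+_ (*-distribˡ-sum a (λ i → F i 0)) (pair-∑ p n (λ i → F i ∘ suc)) ⟩
  ∑[ i < n ] (a * F i 0) + ∑[ i < n ] ⟨ p ∣ F i ∘ suc ⟩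
    ≡⟨ ∑-distrib-+ (λ i → a * F i 0) (λ i → ⟨ p ∣ F i ∘ suc ⟩) ⟨
  ∑[ i < n ] ⟨ a ∷ p ∣ F i ⟩ ∎

pair-⊗ : ∀ a p r g → ⟨ (a ∷ p) ⊗ r ∣ g ⟩ ≡ a * ⟨ r ∣ g ⟩ + ⟨ p ⊗ r ∣ g ∘ suc ⟩
pair-⊗ a p r g = begin
  ⟨ List.map (a *_) r ⊕ (0 ∷ p ⊗ r) ∣ g ⟩         ≡⟨ pair-⊕ (List.map (a *_) r) (0 ∷ p ⊗ r) g ⟩
  ⟨ List.map (a *_) r ∣ g ⟩ + ⟨ p ⊗ r ∣ g ∘ suc ⟩ ≡⟨ cong (_+ ⟨ p ⊗ r ∣ g ∘ suc ⟩) (pair-scale a r g) ⟩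
  a * ⟨ r ∣ g ⟩ + ⟨ p ⊗ r ∣ g ∘ suc ⟩             ∎

pair-geom : ∀ n p g → ⟨ replicate n 1 ⊗ p ∣ g ⟩ ≡ ∑[ j < n ] ⟨ p ∣ (λ k → g (toℕ j + k)) ⟩
pair-geom zero    p g = refl
pair-geom (suc n) p g = trans (pair-⊗ 1 (replicate n 1) p g)
  (cong₂ _+_ (*-identityˡ ⟨ p ∣ g ⟩) (pair-geom n p (g ∘ suc)))

pair-as-∑ : ∀ p N g → length p ≤ N → ∑[ k < N ] (g (toℕ k) * coeff p (toℕ k)) ≡ ⟨ p ∣ g ⟩
pair-as-∑ []      N       g _ = trans (sum-cong-≗ {N} (λ k → *-zeroʳ (g (toℕ k)))) (sum-replicate-zero N)
pair-as-∑ (a ∷ p) (suc N) g (s≤s len≤N) = cong₂ _+_ (*-comm (g 0) a) (pair-as-∑ p N (g ∘ suc) len≤N)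

length-⊕ : ∀ p r n → length p ≤ n → length r ≤ n → length (p ⊕ r) ≤ n
length-⊕ []      r       n       _         r≤n       = r≤n
length-⊕ (a ∷ p) []      n       p≤n       _         = p≤n
length-⊕ (a ∷ p) (b ∷ r) (suc n) (s≤s p≤n) (s≤s r≤n) = s≤s (length-⊕ p r n p≤n r≤n)

length-⊗ : ∀ p r → length (p ⊗ r) ≤ length p + pred (length r)
length-⊗ []      r = z≤n
length-⊗ (a ∷ p) r = length-⊕ (List.map (a *_) r) (0 ∷ p ⊗ r) _
  (subst (_≤ suc (length p + pred (length r))) (sym (length-map (a *_) r)) (scaled r))
  (s≤s (length-⊗ p r))
  where
  scaled : ∀ r → length r ≤ suc (length p + pred (length r))
  scaled []      = z≤n
  scaled (b ∷ r) = s≤s (m≤n+m (length r) (length p))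

length-polyPow : ∀ q L → length (polyPow (geomPoly q) L) ≤ suc (q * L)
length-polyPow q zero    = s≤s z≤n
length-polyPow q (suc L) = ≤-trans (length-⊗ (geomPoly q) (polyPow (geomPoly q) L))
  (subst₂ _≤_ (cong (_+ pred (length (polyPow (geomPoly q) L))) (sym (length-replicate (suc q))))
              (cong suc (sym (*-suc q L)))
              (s≤s (+-monoʳ-≤ q (pred-mono-≤ (length-polyPow q L)))))

powerSum : ℕ → ℕ → ℕ
powerSum q i = ∑[ j < suc q ] (toℕ j ^ i)

momentOf : List ℕ → ℕ → ℕ
momentOf p m = ⟨ p ∣ (λ k → k ^ m) ⟩

momentOf-geom⊗ : ∀ q p m → momentOf (geomPoly q ⊗ p) m
  ≡ ∑[ i < suc m ] ((m C toℕ i) * (powerSum q (toℕ i) * momentOf p (m ∸ toℕ i)))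
momentOf-geom⊗ q p m = begin
  momentOf (geomPoly q ⊗ p) m
    ≡⟨ pair-geom (suc q) p (λ k → k ^ m) ⟩
  ∑[ j < suc q ] ⟨ p ∣ (λ k → (toℕ j + k) ^ m) ⟩
    ≡⟨ sum-cong-≗ {suc q} (λ j → pair-cong p (binomial-theorem m (toℕ j))) ⟩
  ∑[ j < suc q ] ⟨ p ∣ (λ k → ∑[ i < suc m ] (B j i k)) ⟩
    ≡⟨ sum-cong-≗ {suc q} (λ j → pair-∑ p (suc m) (B j)) ⟩
  ∑[ j < suc q ] ∑[ i < suc m ] ⟨ p ∣ B j i ⟩
    ≡⟨ sum-cong-≗ {suc q} (λ j → sum-cong-≗ {suc m} (pull-out j)) ⟩
  ∑[ j < suc q ] ∑[ i < suc m ] ((m C toℕ i) * (toℕ j ^ toℕ i * momentOf p (m ∸ toℕ i)))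
    ≡⟨ ∑-comm {suc q} {suc m} (λ j i → (m C toℕ i) * (toℕ j ^ toℕ i * momentOf p (m ∸ toℕ i))) ⟩
  ∑[ i < suc m ] ∑[ j < suc q ] ((m C toℕ i) * (toℕ j ^ toℕ i * momentOf p (m ∸ toℕ i)))
    ≡⟨ sum-cong-≗ {suc m} factor ⟩
  ∑[ i < suc m ] ((m C toℕ i) * (powerSum q (toℕ i) * momentOf p (m ∸ toℕ i))) ∎
  where
  B : Fin (suc q) → Fin (suc m) → ℕ → ℕ
  B j i k = (m C toℕ i) * (toℕ j ^ toℕ i * k ^ (m ∸ toℕ i))

  pull-out : ∀ j i → ⟨ p ∣ B j i ⟩ ≡ (m C toℕ i) * (toℕ j ^ toℕ i * momentOf p (m ∸ toℕ i))
  pull-out j i = begin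
    ⟨ p ∣ B j i ⟩
      ≡⟨ pair-cong p (λ k → sym (*-assoc (m C toℕ i) (toℕ j ^ toℕ i) (k ^ (m ∸ toℕ i)))) ⟩
    ⟨ p ∣ (λ k → ((m C toℕ i) * toℕ j ^ toℕ i) * k ^ (m ∸ toℕ i)) ⟩
      ≡⟨ pair-* p ((m C toℕ i) * toℕ j ^ toℕ i) (λ k → k ^ (m ∸ toℕ i)) ⟩
    ((m C toℕ i) * toℕ j ^ toℕ i) * momentOf p (m ∸ toℕ i)
      ≡⟨ *-assoc (m C toℕ i) (toℕ j ^ toℕ i) _ ⟩
    (m C toℕ i) * (toℕ j ^ toℕ i * momentOf p (m ∸ toℕ i)) ∎

  factor : ∀ i → ∑[ j < suc q ] ((m C toℕ i) * (toℕ j ^ toℕ i * momentOf p (m ∸ toℕ i)))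
                 ≡ (m C toℕ i) * (powerSum q (toℕ i) * momentOf p (m ∸ toℕ i))
  factor i = begin
    ∑[ j < suc q ] ((m C toℕ i) * (toℕ j ^ toℕ i * momentOf p (m ∸ toℕ i)))
      ≡⟨ *-distribˡ-sum {suc q} (m C toℕ i) (λ j → toℕ j ^ toℕ i * momentOf p (m ∸ toℕ i)) ⟨
    (m C toℕ i) * ∑[ j < suc q ] (toℕ j ^ toℕ i * momentOf p (m ∸ toℕ i))
      ≡⟨ cong ((m C toℕ i) *_) (*-distribʳ-sum {suc q} (momentOf p (m ∸ toℕ i)) (λ j → toℕ j ^ toℕ i)) ⟨
    (m C toℕ i) * (powerSum q (toℕ i) * momentOf p (m ∸ toℕ i)) ∎

powMoment : ℕ → ℕ → ℕ → ℕ
powMoment q L m = momentOf (polyPow (geomPoly q) L) m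

powMoment-step : ∀ q L m → powMoment q (suc L) m
  ≡ ∑[ i < suc m ] ((m C toℕ i) * (powerSum q (toℕ i) * powMoment q L (m ∸ toℕ i)))
powMoment-step q L = momentOf-geom⊗ q (polyPow (geomPoly q) L)

momentSum≡powMoment : ∀ q L m → momentSum q L m ≡ powMoment q L m
momentSum≡powMoment q L m = begin
  momentSum q L m
    ≡⟨ sum-applyUpTo (suc (q * L)) (λ k → k ^ m * ordMultinomial q L k) (λ k → k) ⟩
  ∑[ k < suc (q * L) ] (toℕ k ^ m * coeff (polyPow (geomPoly q) L) (toℕ k))
    ≡⟨ pair-as-∑ (polyPow (geomPoly q) L) (suc (q * L)) (λ k → k ^ m) (length-polyPow q L) ⟩
  powMoment q L m ∎

sum-concatMap : ∀ {A B : Set} (F : A → ℕ) (h : B → List A) xs →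
  sum (List.map F (concatMap h xs)) ≡ sum (List.map (λ x → sum (List.map F (h x))) xs)
sum-concatMap F h []       = refl
sum-concatMap F h (x ∷ xs) = begin
  sum (List.map F (h x List.++ concatMap h xs))
    ≡⟨ cong sum (map-++ F (h x) (concatMap h xs)) ⟩
  sum (List.map F (h x) List.++ List.map F (concatMap h xs))
    ≡⟨ sum-++ (List.map F (h x)) _ ⟩
  sum (List.map F (h x)) + sum (List.map F (concatMap h xs))
    ≡⟨ cong (_+_ (sum (List.map F (h x)))) (sum-concatMap F h xs) ⟩
  sum (List.map F (h x)) + sum (List.map (λ x → sum (List.map F (h x))) xs) ∎

sum-map-*ˡ : ∀ {A : Set} c (f : A → ℕ) xs → sum (List.map (λ x → c * f x) xs) ≡ c * sum (List.map f xs)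
sum-map-*ˡ c f []       = sym (*-zeroʳ c)
sum-map-*ˡ c f (x ∷ xs) = trans (cong (_+_ (c * f x)) (sum-map-*ˡ c f xs)) (sym (*-distribˡ-+ c (f x) _))

-- C(m; i₁,…,i_L) computed as C(m,i₁) · C(m-i₁,i₂) ⋯, the form the recursion produces.
iteratedBinomial : ∀ {L} → ℕ → Vec ℕ L → ℕ
iteratedBinomial m []       = 1
iteratedBinomial m (i ∷ is) = (m C i) * iteratedBinomial (m ∸ i) is

weightProduct : (ℕ → ℕ) → ∀ {L} → Vec ℕ L → ℕ
weightProduct w []       = 1
weightProduct w (i ∷ is) = w i * weightProduct w is

compositionSum : (ℕ → ℕ) → ℕ → ℕ → ℕ
compositionSum w L m =
  sum (List.map (λ is → iteratedBinomial m is * weightProduct w is) (compositions L m))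

-- Splitting off the first part i₁ = i gives the same recursion as the moments.
compositionSum-step : ∀ w L m → compositionSum w (suc L) m
  ≡ ∑[ i < suc m ] ((m C toℕ i) * (w (toℕ i) * compositionSum w L (m ∸ toℕ i)))
compositionSum-step w L m = begin
  compositionSum w (suc L) m
    ≡⟨ sum-concatMap F (λ i → List.map (i ∷_) (compositions L (m ∸ i))) (upTo (suc m)) ⟩
  sum (List.map (λ i → sum (List.map F (List.map (i ∷_) (compositions L (m ∸ i))))) (upTo (suc m)))
    ≡⟨ sum-applyUpTo (suc m) _ (λ i → i) ⟩
  ∑[ i < suc m ] sum (List.map F (List.map (toℕ i ∷_) (compositions L (m ∸ toℕ i))))
    ≡⟨ sum-cong-≗ {suc m} (λ i → first-part (toℕ i)) ⟩
  ∑[ i < suc m ] ((m C toℕ i) * (w (toℕ i) * compositionSum w L (m ∸ toℕ i))) ∎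
  where
  F : Vec ℕ (suc L) → ℕ
  F is = iteratedBinomial m is * weightProduct w is

  rearrange : ∀ c k x p → (c * k) * (x * p) ≡ (c * x) * (k * p)
  rearrange = solve-∀

  first-part : ∀ i → sum (List.map F (List.map (i ∷_) (compositions L (m ∸ i))))
                     ≡ (m C i) * (w i * compositionSum w L (m ∸ i))
  first-part i = begin
    sum (List.map F (List.map (i ∷_) cs))
      ≡⟨ cong sum (map-∘ cs) ⟨
    sum (List.map (λ is → ((m C i) * iteratedBinomial (m ∸ i) is) * (w i * weightProduct w is)) cs)
      ≡⟨ cong sum (map-cong (λ is →
           rearrange (m C i) (iteratedBinomial (m ∸ i) is) (w i) (weightProduct w is)) cs) ⟩
    sum (List.map (λ is → ((m C i) * w i) * (iteratedBinomial (m ∸ i) is * weightProduct w is)) cs)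
      ≡⟨ sum-map-*ˡ ((m C i) * w i) _ cs ⟩
    ((m C i) * w i) * compositionSum w L (m ∸ i)
      ≡⟨ *-assoc (m C i) (w i) _ ⟩
    (m C i) * (w i * compositionSum w L (m ∸ i)) ∎
    where cs = compositions L (m ∸ i)

powMoment≡compositionSum : ∀ q L m → powMoment q L m ≡ compositionSum (powerSum q) L m
powMoment≡compositionSum q zero    zero    = refl
powMoment≡compositionSum q zero    (suc m) = refl
powMoment≡compositionSum q (suc L) m = begin
  powMoment q (suc L) m
    ≡⟨ powMoment-step q L m ⟩
  ∑[ i < suc m ] ((m C toℕ i) * (powerSum q (toℕ i) * powMoment q L (m ∸ toℕ i)))
    ≡⟨ sum-cong-≗ {suc m} (λ i → cong (λ x → (m C toℕ i) * (powerSum q (toℕ i) * x))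
                                       (powMoment≡compositionSum q L (m ∸ toℕ i))) ⟩
  ∑[ i < suc m ] ((m C toℕ i) * (powerSum q (toℕ i) * compositionSum (powerSum q) L (m ∸ toℕ i)))
    ≡⟨ compositionSum-step (powerSum q) L m ⟨
  compositionSum (powerSum q) (suc L) m ∎

factorial-split : ∀ {m i} → i ≤ m → m ! ≡ (m C i) * (i ! * (m ∸ i) !)
factorial-split {m} {i} i≤m = sym (begin
  (m C i) * (i ! * (m ∸ i) !)
    ≡⟨ cong (_* (i ! * (m ∸ i) !)) (nCk≡n!/k![n-k]! i≤m) ⟩
  (m ! Data.Nat./ (i ! * (m ∸ i) !)) {{i !* (m ∸ i) !≢0}} * (i ! * (m ∸ i) !)
    ≡⟨ m/n*n≡m {{i !* (m ∸ i) !≢0}} (k![n∸k]!∣n! i≤m) ⟩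
  m ! ∎)

factorials-on-compositions : ∀ L m →
  All (λ is → m ! ≡ iteratedBinomial m is * prodFact is) (compositions L m)
factorials-on-compositions zero    zero    = refl ∷ []
factorials-on-compositions zero    (suc m) = []
factorials-on-compositions (suc L) m =
  concat⁺ (map⁺ (applyUpTo⁺₁ (λ i → i) (suc m) (λ {i} i<1+m →
    map⁺ (All.map (λ {is} → extend (≤-pred i<1+m) {is}) (factorials-on-compositions L (m ∸ i))))))
  where
  rearrange : ∀ c f k p → c * (f * (k * p)) ≡ (c * k) * (f * p)
  rearrange = solve-∀

  extend : ∀ {i} → i ≤ m → ∀ {is : Vec ℕ L} →
    (m ∸ i) ! ≡ iteratedBinomial (m ∸ i) is * prodFact is →
    m ! ≡ iteratedBinomial m (i ∷ is) * prodFact (i ∷ is)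
  extend {i} i≤m {is} ih = begin
    m !                                                              ≡⟨ factorial-split i≤m ⟩
    (m C i) * (i ! * (m ∸ i) !)                                      ≡⟨ cong (λ x → (m C i) * (i ! * x)) ih ⟩
    (m C i) * (i ! * (iteratedBinomial (m ∸ i) is * prodFact is))    ≡⟨ rearrange (m C i) (i !) _ _ ⟩
    iteratedBinomial m (i ∷ is) * prodFact (i ∷ is)                  ∎

multinomial≡iteratedBinomial : ∀ {L} m (is : Vec ℕ L) →
  m ! ≡ iteratedBinomial m is * prodFact is → multinomial m is ≡ iteratedBinomial m is
multinomial≡iteratedBinomial m is m!≡ = begin
  (m ! Data.Nat./ prodFact is) {{prodFact≢0 is}}
    ≡⟨ cong (λ x → (x Data.Nat./ prodFact is) {{prodFact≢0 is}}) m!≡ ⟩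
  (iteratedBinomial m is * prodFact is Data.Nat./ prodFact is) {{prodFact≢0 is}}
    ≡⟨ m*n/n≡m (iteratedBinomial m is) (prodFact is) {{prodFact≢0 is}} ⟩
  iteratedBinomial m is ∎

multinomialSum≡compositionSum : ∀ w L m →
  sum (List.map (λ is → multinomial m is * weightProduct w is) (compositions L m)) ≡ compositionSum w L m
multinomialSum≡compositionSum w L m = cong sum (map-cong-local
  (All.map (λ {is} e → cong (_* weightProduct w is) (multinomial≡iteratedBinomial m is e))
           (factorials-on-compositions L m)))

frac-≡ : ∀ {a b c d} → a * suc d ≡ b * suc c → (+ a) / suc c ≡ (+ b) / suc d
frac-≡ {a} {b} {c} {d} cross = fromℚᵘ-cong {mkℚᵘ (+ a) c} {mkℚᵘ (+ b) d} (*≡* (begin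
  (+ a) ℤ.* (+ suc d)  ≡⟨ pos-* a (suc d) ⟨
  + (a * suc d)        ≡⟨ cong +_ cross ⟩
  + (b * suc c)        ≡⟨ pos-* b (suc c) ⟩
  (+ b) ℤ.* (+ suc c)  ∎))

fromℚᵘ-* : ∀ (p q : ℚᵘ) → fromℚᵘ (p ℚᵘ.* q) ≡ fromℚᵘ p *ℚ fromℚᵘ q
fromℚᵘ-* p q = toℚᵘ-injective (ℚᵘ.≃-trans (toℚᵘ-fromℚᵘ (p ℚᵘ.* q)) (ℚᵘ.≃-sym
  (ℚᵘ.≃-trans (toℚᵘ-homo-* (fromℚᵘ p) (fromℚᵘ q)) (ℚᵘ.*-cong (toℚᵘ-fromℚᵘ p) (toℚᵘ-fromℚᵘ q)))))

fromℚᵘ-+ : ∀ (p q : ℚᵘ) → fromℚᵘ (p ℚᵘ.+ q) ≡ fromℚᵘ p +ℚ fromℚᵘ q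
fromℚᵘ-+ p q = toℚᵘ-injective (ℚᵘ.≃-trans (toℚᵘ-fromℚᵘ (p ℚᵘ.+ q)) (ℚᵘ.≃-sym
  (ℚᵘ.≃-trans (toℚᵘ-homo-+ (fromℚᵘ p) (fromℚᵘ q)) (ℚᵘ.+-cong (toℚᵘ-fromℚᵘ p) (toℚᵘ-fromℚᵘ q)))))

frac-* : ∀ a b c d → ((+ a) / suc c) *ℚ ((+ b) / suc d) ≡ (+ (a * b)) / (suc c * suc d)
frac-* a b c d = trans (sym (fromℚᵘ-* (mkℚᵘ (+ a) c) (mkℚᵘ (+ b) d)))
                       (/-cong (sym (pos-* a b)) refl)

frac-+ : ∀ a b c d → ((+ a) / suc c) +ℚ ((+ b) / suc d) ≡ (+ (a * suc d + b * suc c)) / (suc c * suc d)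
frac-+ a b c d = trans (sym (fromℚᵘ-+ (mkℚᵘ (+ a) c) (mkℚᵘ (+ b) d)))
  (/-cong (begin
    (+ a) ℤ.* (+ suc d) ℤ.+ (+ b) ℤ.* (+ suc c)  ≡⟨ cong₂ ℤ._+_ (pos-* a (suc d)) (pos-* b (suc c)) ⟨
    + (a * suc d) ℤ.+ + (b * suc c)             ≡⟨ pos-+ (a * suc d) (b * suc c) ⟨
    + (a * suc d + b * suc c)                   ∎) refl)

toℚ-* : ∀ a b → toℚ (a * b) ≡ toℚ a *ℚ toℚ b
toℚ-* a b = sym (frac-* a b 0 0)

toℚ-+ : ∀ a b → toℚ (a + b) ≡ toℚ a +ℚ toℚ b
toℚ-+ a b = sym (trans (frac-+ a b 0 0)
  (cong (λ n → (+ n) / 1) (cong₂ _+_ (*-identityʳ a) (*-identityʳ b))))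

toℚ-sum : ∀ {A : Set} (f : A → ℕ) xs → sumℚ (List.map (toℚ ∘ f) xs) ≡ toℚ (sum (List.map f xs))
toℚ-sum f []       = refl
toℚ-sum f (x ∷ xs) = trans (cong (toℚ (f x) +ℚ_) (toℚ-sum f xs)) (sym (toℚ-+ (f x) _))

sumℚ-*ˡ : ∀ {A : Set} c (f : A → ℚ) xs → c *ℚ sumℚ (List.map f xs) ≡ sumℚ (List.map (λ x → c *ℚ f x) xs)
sumℚ-*ˡ c f []       = ℚ.*-zeroʳ c
sumℚ-*ˡ c f (x ∷ xs) = trans (ℚ.*-distribˡ-+ c (f x) _) (cong (c *ℚ f x +ℚ_) (sumℚ-*ˡ c f xs))

size*moment : ∀ q i → toℚ (q + 1) *ℚ moment q i ≡ toℚ (powerSum q i)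
size*moment q i = begin
  toℚ (q + 1) *ℚ moment q i
    ≡⟨ cong (λ n → toℚ (q + 1) *ℚ ((+ n) / suc q)) (sum-applyUpTo (suc q) (λ j → j ^ i) (λ j → j)) ⟩
  toℚ (q + 1) *ℚ ((+ powerSum q i) / suc q)
    ≡⟨ frac-* (q + 1) (powerSum q i) 0 q ⟩
  (+ ((q + 1) * powerSum q i)) / (1 * suc q)
    ≡⟨ frac-≡ {(q + 1) * powerSum q i} {powerSum q i} {q + 0} {0} (cancel (powerSum q i) q) ⟩
  toℚ (powerSum q i) ∎
  where
  cancel : ∀ s q → (q + 1) * s * 1 ≡ s * suc (q + 0)
  cancel = solve-∀

clear-denominators : ∀ q {L} (is : Vec ℕ L) →
  toℚ ((q + 1) ^ L) *ℚ prodℚ (map (moment q) is) ≡ toℚ (weightProduct (powerSum q) is)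
clear-denominators q []       = ℚ.*-identityʳ (toℚ 1)
clear-denominators q {suc L} (i ∷ is) = begin
  toℚ ((q + 1) * (q + 1) ^ L) *ℚ (moment q i *ℚ U)
    ≡⟨ cong (_*ℚ (moment q i *ℚ U)) (toℚ-* (q + 1) ((q + 1) ^ L)) ⟩
  (toℚ (q + 1) *ℚ toℚ ((q + 1) ^ L)) *ℚ (moment q i *ℚ U)
    ≡⟨ ℚ-*.interchange (toℚ (q + 1)) (toℚ ((q + 1) ^ L)) (moment q i) U ⟩
  (toℚ (q + 1) *ℚ moment q i) *ℚ (toℚ ((q + 1) ^ L) *ℚ U)
    ≡⟨ cong₂ _*ℚ_ (size*moment q i) (clear-denominators q is) ⟩
  toℚ (powerSum q i) *ℚ toℚ (weightProduct (powerSum q) is)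
    ≡⟨ toℚ-* (powerSum q i) _ ⟨
  toℚ (weightProduct (powerSum q) (i ∷ is)) ∎
  where U = prodℚ (map (moment q) is)

moment-formula : ∀ q L m → toℚ (momentSum q L m) ≡ toℚ ((q + 1) ^ L)
  *ℚ sumℚ (List.map (λ is → toℚ (multinomial m is) *ℚ prodℚ (map (moment q) is)) (compositions L m))
moment-formula q L m = sym (begin
  N *ℚ sumℚ (List.map (λ is → toℚ (multinomial m is) *ℚ prodℚ (map (moment q) is)) cs)
    ≡⟨ sumℚ-*ˡ N _ cs ⟩
  sumℚ (List.map (λ is → N *ℚ (toℚ (multinomial m is) *ℚ prodℚ (map (moment q) is))) cs)
    ≡⟨ cong sumℚ (map-cong term cs) ⟩
  sumℚ (List.map (λ is → toℚ (multinomial m is * weightProduct (powerSum q) is)) cs)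
    ≡⟨ toℚ-sum (λ is → multinomial m is * weightProduct (powerSum q) is) cs ⟩
  toℚ (sum (List.map (λ is → multinomial m is * weightProduct (powerSum q) is) cs))
    ≡⟨ cong toℚ (multinomialSum≡compositionSum (powerSum q) L m) ⟩
  toℚ (compositionSum (powerSum q) L m)
    ≡⟨ cong toℚ (trans (momentSum≡powMoment q L m) (powMoment≡compositionSum q L m)) ⟨
  toℚ (momentSum q L m) ∎)
  where
  N  = toℚ ((q + 1) ^ L)
  cs = compositions L m

  term : ∀ is → N *ℚ (toℚ (multinomial m is) *ℚ prodℚ (map (moment q) is))
                ≡ toℚ (multinomial m is * weightProduct (powerSum q) is)
  term is = begin
    N *ℚ (toℚ (multinomial m is) *ℚ prodℚ (map (moment q) is))
      ≡⟨ ℚ-*.x∙yz≈y∙xz N (toℚ (multinomial m is)) _ ⟩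
    toℚ (multinomial m is) *ℚ (N *ℚ prodℚ (map (moment q) is))
      ≡⟨ cong (toℚ (multinomial m is) *ℚ_) (clear-denominators q is) ⟩
    toℚ (multinomial m is) *ℚ toℚ (weightProduct (powerSum q) is)
      ≡⟨ toℚ-* (multinomial m is) _ ⟨
    toℚ (multinomial m is * weightProduct (powerSum q) is) ∎

powerSum-closed : ∀ c i (F : ℕ → ℕ) → c * powerSum 0 i ≡ F 0 →
  (∀ q → F q + c * suc q ^ i ≡ F (suc q)) → ∀ q → c * powerSum q i ≡ F q
powerSum-closed c i F base step zero    = base
powerSum-closed c i F base step (suc q) = begin
  c * powerSum (suc q) i          ≡⟨ cong (c *_) (∑-snoc (suc q) (λ j → j ^ i)) ⟩
  c * (powerSum q i + suc q ^ i)  ≡⟨ *-distribˡ-+ c (powerSum q i) _ ⟩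
  c * powerSum q i + c * suc q ^ i ≡⟨ cong (_+ c * suc q ^ i) (powerSum-closed c i F base step q) ⟩
  F q + c * suc q ^ i             ≡⟨ step q ⟩
  F (suc q)                       ∎

powerSum-0 : ∀ q → powerSum q 0 ≡ q + 1
powerSum-0 q = trans (sym (*-identityˡ _)) (powerSum-closed 1 0 (λ q → q + 1) refl increment q)
  where
  increment : ∀ q → q + 1 + 1 * 1 ≡ suc q + 1
  increment = solve-∀

powerSum-1 : ∀ q → 2 * powerSum q 1 ≡ q * (q + 1)
powerSum-1 = powerSum-closed 2 1 (λ q → q * (q + 1)) refl increment
  where
  increment : ∀ q → q * (q + 1) + 2 * (suc q * 1) ≡ suc q * (suc q + 1)
  increment = solve-∀

powerSum-2 : ∀ q → 6 * powerSum q 2 ≡ q * (q + 1) * (2 * q + 1)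
powerSum-2 = powerSum-closed 6 2 (λ q → q * (q + 1) * (2 * q + 1)) refl increment
  where
  increment : ∀ q → q * (q + 1) * (2 * q + 1) + 6 * (suc q * (suc q * 1))
                    ≡ suc q * (suc q + 1) * (2 * suc q + 1)
  increment = solve-∀

powerSum-3 : ∀ q → 4 * powerSum q 3 ≡ q * q * (q + 1) * (q + 1)
powerSum-3 = powerSum-closed 4 3 (λ q → q * q * (q + 1) * (q + 1)) refl increment
  where
  increment : ∀ q → q * q * (q + 1) * (q + 1) + 4 * (suc q * (suc q * (suc q * 1)))
                    ≡ suc q * suc q * (suc q + 1) * (suc q + 1)
  increment = solve-∀

-- Each moment closed form is proved by induction on L via powMoment-step:
-- scale the recursion so that only the already-known cleared quantities occur,
-- substitute them, and normalise.
moment-0 : ∀ q L → powMoment q L 0 ≡ (q + 1) ^ L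
moment-0 q zero    = refl
moment-0 q (suc L) = begin
  powMoment q (suc L) 0                 ≡⟨ trans (powMoment-step q L 0) (expand (powerSum q 0) _) ⟩
  powerSum q 0 * powMoment q L 0        ≡⟨ cong₂ _*_ (powerSum-0 q) (moment-0 q L) ⟩
  (q + 1) * (q + 1) ^ L                 ∎
  where
  expand : ∀ s M → 1 * (s * M) + 0 ≡ s * M
  expand = solve-∀

moment-1 : ∀ q L → 2 * powMoment q L 1 ≡ (q + 1) ^ L * (q * L)
moment-1 q zero    = base q
  where
  base : ∀ q → 0 ≡ 1 * (q * 0)
  base = solve-∀
moment-1 q (suc L) = begin
  2 * powMoment q (suc L) 1
    ≡⟨ trans (cong (2 *_) (powMoment-step q L 1)) (expand (s 0) (s 1) (M 0) (M 1)) ⟩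
  s 0 * (2 * M 1) + (2 * s 1) * M 0
    ≡⟨ cong₂ _+_ (cong₂ _*_ (powerSum-0 q) (moment-1 q L)) (cong₂ _*_ (powerSum-1 q) (moment-0 q L)) ⟩
  (q + 1) * ((q + 1) ^ L * (q * L)) + q * (q + 1) * (q + 1) ^ L
    ≡⟨ collect q L ((q + 1) ^ L) ⟩
  (q + 1) ^ suc L * (q * suc L) ∎
  where
  s = powerSum q
  M = powMoment q L
  expand : ∀ s₀ s₁ M₀ M₁ → 2 * (1 * (s₀ * M₁) + (1 * (s₁ * M₀) + 0)) ≡ s₀ * (2 * M₁) + (2 * s₁) * M₀
  expand = solve-∀
  collect : ∀ q L N → (q + 1) * (N * (q * L)) + q * (q + 1) * N ≡ ((q + 1) * N) * (q * suc L)
  collect = solve-∀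

moment-2 : ∀ q L → 12 * powMoment q L 2 ≡ (q + 1) ^ L * (q * L) * (3 * (q * L) + q + 2)
moment-2 q zero    = base q
  where
  base : ∀ q → 0 ≡ 1 * (q * 0) * (3 * (q * 0) + q + 2)
  base = solve-∀
moment-2 q (suc L) = begin
  12 * powMoment q (suc L) 2
    ≡⟨ trans (cong (12 *_) (powMoment-step q L 2)) (expand (s 0) (s 1) (s 2) (M 0) (M 1) (M 2)) ⟩
  s 0 * (12 * M 2) + 6 * ((2 * s 1) * (2 * M 1)) + 2 * ((6 * s 2) * M 0)
    ≡⟨ cong₂ _+_ (cong₂ _+_ (cong₂ _*_ (powerSum-0 q) (moment-2 q L))
                           (cong (6 *_) (cong₂ _*_ (powerSum-1 q) (moment-1 q L))))
                 (cong (2 *_) (cong₂ _*_ (powerSum-2 q) (moment-0 q L))) ⟩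
  (q + 1) * (N * (q * L) * (3 * (q * L) + q + 2)) + 6 * ((q * (q + 1)) * (N * (q * L)))
    + 2 * ((q * (q + 1) * (2 * q + 1)) * N)
    ≡⟨ collect q L N ⟩
  (q + 1) ^ suc L * (q * suc L) * (3 * (q * suc L) + q + 2) ∎
  where
  s = powerSum q
  M = powMoment q L
  N = (q + 1) ^ L
  expand : ∀ s₀ s₁ s₂ M₀ M₁ M₂ → 12 * (1 * (s₀ * M₂) + (2 * (s₁ * M₁) + (1 * (s₂ * M₀) + 0)))
    ≡ s₀ * (12 * M₂) + 6 * ((2 * s₁) * (2 * M₁)) + 2 * ((6 * s₂) * M₀)
  expand = solve-∀
  collect : ∀ q L N → (q + 1) * (N * (q * L) * (3 * (q * L) + q + 2)) + 6 * ((q * (q + 1)) * (N * (q * L)))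
    + 2 * ((q * (q + 1) * (2 * q + 1)) * N) ≡ ((q + 1) * N) * (q * suc L) * (3 * (q * suc L) + q + 2)
  collect = solve-∀

moment-3 : ∀ q L → 8 * powMoment q L 3 ≡ (q + 1) ^ L * (q * L) * (q * L) * (q * L + q + 2)
moment-3 q zero    = base q
  where
  base : ∀ q → 0 ≡ 1 * (q * 0) * (q * 0) * (q * 0 + q + 2)
  base = solve-∀
moment-3 q (suc L) = begin
  8 * powMoment q (suc L) 3
    ≡⟨ trans (cong (8 *_) (powMoment-step q L 3))
             (expand (s 0) (s 1) (s 2) (s 3) (M 0) (M 1) (M 2) (M 3)) ⟩
  s 0 * (8 * M 3) + (2 * s 1) * (12 * M 2) + 2 * ((6 * s 2) * (2 * M 1)) + 2 * ((4 * s 3) * M 0)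
    ≡⟨ cong₂ _+_ (cong₂ _+_ (cong₂ _+_ (cong₂ _*_ (powerSum-0 q) (moment-3 q L))
                                      (cong₂ _*_ (powerSum-1 q) (moment-2 q L)))
                           (cong (2 *_) (cong₂ _*_ (powerSum-2 q) (moment-1 q L))))
                 (cong (2 *_) (cong₂ _*_ (powerSum-3 q) (moment-0 q L))) ⟩
  (q + 1) * (N * (q * L) * (q * L) * (q * L + q + 2))
    + (q * (q + 1)) * (N * (q * L) * (3 * (q * L) + q + 2))
    + 2 * ((q * (q + 1) * (2 * q + 1)) * (N * (q * L))) + 2 * ((q * q * (q + 1) * (q + 1)) * N)
    ≡⟨ collect q L N ⟩
  (q + 1) ^ suc L * (q * suc L) * (q * suc L) * (q * suc L + q + 2) ∎
  where
  s = powerSum q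
  M = powMoment q L
  N = (q + 1) ^ L
  expand : ∀ s₀ s₁ s₂ s₃ M₀ M₁ M₂ M₃ →
    8 * (1 * (s₀ * M₃) + (3 * (s₁ * M₂) + (3 * (s₂ * M₁) + (1 * (s₃ * M₀) + 0))))
    ≡ s₀ * (8 * M₃) + (2 * s₁) * (12 * M₂) + 2 * ((6 * s₂) * (2 * M₁)) + 2 * ((4 * s₃) * M₀)
  expand = solve-∀
  collect : ∀ q L N → (q + 1) * (N * (q * L) * (q * L) * (q * L + q + 2))
    + (q * (q + 1)) * (N * (q * L) * (3 * (q * L) + q + 2))
    + 2 * ((q * (q + 1) * (2 * q + 1)) * (N * (q * L))) + 2 * ((q * q * (q + 1) * (q + 1)) * N)
    ≡ ((q + 1) * N) * (q * suc L) * (q * suc L) * (q * suc L + q + 2)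
  collect = solve-∀

toℚ-divide : ∀ x y d → suc d * x ≡ y → toℚ x ≡ (+ y) / suc d
toℚ-divide x y d e = frac-≡ {x} {y} {0} {d} (trans (*-comm x (suc d)) (trans e (sym (*-identityʳ y))))

first-moment : ∀ q L → toℚ (momentSum q L 1) ≡ toℚ ((q + 1) ^ L) *ℚ ((+ (q * L)) / 2)
first-moment q L = begin
  toℚ (momentSum q L 1)
    ≡⟨ toℚ-divide (momentSum q L 1) ((q + 1) ^ L * (q * L)) 1
         (trans (cong (2 *_) (momentSum≡powMoment q L 1)) (moment-1 q L)) ⟩
  (+ ((q + 1) ^ L * (q * L))) / 2
    ≡⟨ frac-* ((q + 1) ^ L) (q * L) 0 1 ⟨
  toℚ ((q + 1) ^ L) *ℚ ((+ (q * L)) / 2) ∎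

second-moment : ∀ q L → toℚ (momentSum q L 2) ≡ toℚ ((q + 1) ^ L) *ℚ ((+ (q * L)) / 2)
  *ℚ ((+ (q * L)) / 2 +ℚ (+ (q + 2)) / 6)
second-moment q L = begin
  toℚ (momentSum q L 2)
    ≡⟨ toℚ-divide (momentSum q L 2) (N * a * (a * 6 + (q + 2) * 2)) 23 cleared ⟩
  (+ (N * a * (a * 6 + (q + 2) * 2))) / 24
    ≡⟨ frac-* (N * a) (a * 6 + (q + 2) * 2) 1 11 ⟨
  ((+ (N * a)) / 2) *ℚ ((+ (a * 6 + (q + 2) * 2)) / 12)
    ≡⟨ cong₂ _*ℚ_ (frac-* N a 0 1) (frac-+ a (q + 2) 1 5) ⟨
  toℚ N *ℚ ((+ a) / 2) *ℚ ((+ a) / 2 +ℚ (+ (q + 2)) / 6) ∎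
  where
  N = (q + 1) ^ L
  a = q * L
  cleared : 24 * momentSum q L 2 ≡ N * a * (a * 6 + (q + 2) * 2)
  cleared = begin
    24 * momentSum q L 2                ≡⟨ *-assoc 2 12 (momentSum q L 2) ⟩
    2 * (12 * momentSum q L 2)          ≡⟨ cong (λ x → 2 * (12 * x)) (momentSum≡powMoment q L 2) ⟩
    2 * (12 * powMoment q L 2)          ≡⟨ cong (2 *_) (moment-2 q L) ⟩
    2 * (N * a * (3 * a + q + 2))       ≡⟨ normalise N a q ⟩
    N * a * (a * 6 + (q + 2) * 2)       ∎
    where
    normalise : ∀ N a q → 2 * (N * a * (3 * a + q + 2)) ≡ N * a * (a * 6 + (q + 2) * 2)
    normalise = solve-∀

third-moment : ∀ q L → toℚ (momentSum q L 3) ≡ toℚ ((q + 1) ^ L) *ℚ ((+ (q * L)) / 2) *ℚ ((+ (q * L)) / 2)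
  *ℚ ((+ (q * L)) / 2 +ℚ (+ (q + 2)) / 2)
third-moment q L = begin
  toℚ (momentSum q L 3)
    ≡⟨ toℚ-divide (momentSum q L 3) (N * a * a * (a * 2 + (q + 2) * 2)) 15 cleared ⟩
  (+ (N * a * a * (a * 2 + (q + 2) * 2))) / 16
    ≡⟨ frac-* (N * a * a) (a * 2 + (q + 2) * 2) 3 3 ⟨
  ((+ (N * a * a)) / 4) *ℚ ((+ (a * 2 + (q + 2) * 2)) / 4)
    ≡⟨ cong₂ _*ℚ_ (trans (cong (_*ℚ ((+ a) / 2)) (frac-* N a 0 1)) (frac-* (N * a) a 1 1))
                  (frac-+ a (q + 2) 1 1) ⟨
  toℚ N *ℚ ((+ a) / 2) *ℚ ((+ a) / 2) *ℚ ((+ a) / 2 +ℚ (+ (q + 2)) / 2) ∎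
  where
  N = (q + 1) ^ L
  a = q * L
  cleared : 16 * momentSum q L 3 ≡ N * a * a * (a * 2 + (q + 2) * 2)
  cleared = begin
    16 * momentSum q L 3                ≡⟨ *-assoc 2 8 (momentSum q L 3) ⟩
    2 * (8 * momentSum q L 3)           ≡⟨ cong (λ x → 2 * (8 * x)) (momentSum≡powMoment q L 3) ⟩
    2 * (8 * powMoment q L 3)           ≡⟨ cong (2 *_) (moment-3 q L) ⟩
    2 * (N * a * a * (a + q + 2))       ≡⟨ normalise N a q ⟩
    N * a * a * (a * 2 + (q + 2) * 2)   ∎
    where
    normalise : ∀ N a q → 2 * (N * a * a * (a + q + 2)) ≡ N * a * a * (a * 2 + (q + 2) * 2)
    normalise = solve-∀

-- The identities hold for all q and L.
corollary7 : (q L : ℕ) → q ≥ 1 → L ≥ 1 →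
      (toℚ (momentSum q L 1) ≡ toℚ ((q + 1) ^ L) *ℚ ((+ (q * L)) / 2))
    × (toℚ (momentSum q L 2) ≡ toℚ ((q + 1) ^ L) *ℚ ((+ (q * L)) / 2)
          *ℚ ((+ (q * L)) / 2 +ℚ (+ (q + 2)) / 6))
    × (toℚ (momentSum q L 3) ≡ toℚ ((q + 1) ^ L) *ℚ ((+ (q * L)) / 2) *ℚ ((+ (q * L)) / 2)
          *ℚ ((+ (q * L)) / 2 +ℚ (+ (q + 2)) / 2))
    × ((m : ℕ) → m ≥ 1 →
        toℚ (momentSum q L m) ≡ toℚ ((q + 1) ^ L)
          *ℚ sumℚ (List.map (λ is → toℚ (multinomial m is) *ℚ prodℚ (map (moment q) is))
                            (compositions L m)))
corollary7 q L _ _ =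
  first-moment q L , second-moment q L , third-moment q L , λ m _ → moment-formula q L m
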